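{- $W_6$ is a minor of each of the graphs $L(K_{3,3})$, $AW^+_6$, and $K_{4,4}-3K_2$.
   Context: All graphs are finite and simple. For $n\ge 3$, the wheel $W_n$ is a cycle $C_n$ plus one new vertex adjacent to all cycle vertices. $L(K_{3,3})$ is the line graph of $K_{3,3}$ (vertices are the edges of $K_{3,3}$, adjacent when they share an end). $AW^+_6$ is obtained from a cycle $c_1c_2\cdots c_6c_1$ by adding two adjacent new vertices $u,v$, with $u$ adjacent to $c_1,c_3,c_5$ and $v$ adjacent to $c_2,c_4,c_6$. $K_{4,4}-3K_2$ is the graph obtained from $K_{4,4}$ by deleting three pairwise nonincident edges. A minor is obtained by deleting vertices/edges and contracting edges (simplifying). -}

module Defs where

open import Data.Nat using (ℕ; zero; suc)
open import Data.Fin using (Fin; zero; suc; toℕ)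
open import Data.Fin.Patterns
open import Data.Bool using (Bool; true; false; T; _∧_; _∨_; not)
open import Data.Maybe using (Maybe; just; nothing)
open import Data.Product using (Σ; ∃; _×_; _,_)
open import Data.Empty using (⊥)
open import Relation.Nullary using (¬_)
open import Relation.Binary.PropositionalEquality using (_≡_)
open import Data.Nat using (_≡ᵇ_; _<ᵇ_)

record Graph : Set where
  field
    n     : ℕ
    adj   : Fin n → Fin n → Bool
    sym   : ∀ x y → adj x y ≡ adj y x
    irrefl : ∀ x → adj x x ≡ false

open Graph public

Adj : (G : Graph) → Fin (n G) → Fin (n G) → Set
Adj G x y = T (adj G x y)

data WalkIn (G : Graph) (S : Fin (n G) → Set) : Fin (n G) → Fin (n G) → Set where
  here : ∀ {x} → S x → WalkIn G S x x
  step : ∀ {x z y} → S x → Adj G x z → WalkIn G S z y → WalkIn G S x y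

-- H is a minor of G, via a minor model (branch sets):
-- φ assigns each vertex of G to at most one vertex of H (so the branch
-- sets  φ⁻¹(just a)  are pairwise disjoint); every branch set is nonempty
-- and induces a connected subgraph of G; and for every edge ab of H there
-- is an edge of G between the branch sets of a and b.
record MinorModel (H G : Graph) : Set where
  field
    φ         : Fin (n G) → Maybe (Fin (n H))
    nonempty  : ∀ a → ∃ λ x → φ x ≡ just a
    connected : ∀ a x y → φ x ≡ just a → φ y ≡ just a →
                WalkIn G (λ z → φ z ≡ just a) x y
    edges     : ∀ a b → Adj H a b →
                ∃ λ x → ∃ λ y → φ x ≡ just a × φ y ≡ just b × Adj G x y

_≼_ : Graph → Graph → Set
H ≼ G = MinorModel H G

infix 4 _==_
_==_ : ℕ → ℕ → Bool
_==_ = _≡ᵇ_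

symClose : ∀ {k} → (Fin k → Fin k → Bool) → Fin k → Fin k → Bool
symClose r x y = r x y ∨ r y x

simpleClose : ∀ {k} → (Fin k → Fin k → Bool) → Fin k → Fin k → Bool
simpleClose r x y = not (toℕ x == toℕ y) ∧ (r x y ∨ r y x)

mkGraph : (k : ℕ) → (Fin k → Fin k → Bool) → Graph
mkGraph k r = record { n = k ; adj = simpleClose r ; sym = symP ; irrefl = irrP }
  where
  open import Data.Bool.Properties using (∨-comm)
  open import Data.Nat.Properties using (≡ᵇ⇒≡; ≡⇒≡ᵇ)
  open import Relation.Binary.PropositionalEquality using (refl; cong; cong₂; sym)
  ==-sym : ∀ a b → (a == b) ≡ (b == a)
  ==-sym zero zero = refl
  ==-sym zero (suc b) = refl
  ==-sym (suc a) zero = refl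
  ==-sym (suc a) (suc b) = ==-sym a b
  ==-refl : ∀ a → (a == a) ≡ true
  ==-refl zero = refl
  ==-refl (suc a) = ==-refl a
  symP : ∀ x y → simpleClose r x y ≡ simpleClose r y x
  symP x y = cong₂ _∧_ (cong not (==-sym (toℕ x) (toℕ y))) (∨-comm (r x y) (r y x))
  irrP : ∀ x → simpleClose r x x ≡ false
  irrP x rewrite ==-refl (toℕ x) = refl

W6 : Graph
W6 = mkGraph 7 λ x y →
  let i = toℕ x ; j = toℕ y in
  ((i <ᵇ 6) ∧ (j <ᵇ 6) ∧ ((suc i == j) ∨ ((i == 5) ∧ (j == 0))))
  ∨ ((i <ᵇ 6) ∧ (j == 6))

-- L(K₃,₃): the edges of K₃,₃ are pairs (p,q) with p on the left side and
-- q on the right side, p,q ∈ {0,1,2}; edge (p,q) is encoded as vertex 3p+q.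
-- Two distinct edges are adjacent iff they share an end (same p or same q).

LK33 : Graph
LK33 = mkGraph 9 λ x y →
  let i = toℕ x ; j = toℕ y in
  (i / 3 == j / 3) ∨ (i % 3 == j % 3)
  where open import Data.Nat.DivMod using (_/_; _%_)

-- AW⁺₆: cycle c₁c₂…c₆c₁ encoded as vertices 0..5 (c_{i+1} = i),
-- u = 6 adjacent to c₁,c₃,c₅ (= 0,2,4), v = 7 adjacent to c₂,c₄,c₆
-- (= 1,3,5), and u adjacent to v.

AW6+ : Graph
AW6+ = mkGraph 8 λ x y →
  let i = toℕ x ; j = toℕ y in
  ((i <ᵇ 6) ∧ (j <ᵇ 6) ∧ ((suc i == j) ∨ ((i == 5) ∧ (j == 0))))
  ∨ ((j == 6) ∧ ((i == 0) ∨ (i == 2) ∨ (i == 4)))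
  ∨ ((j == 7) ∧ ((i == 1) ∨ (i == 3) ∨ (i == 5)))
  ∨ ((i == 6) ∧ (j == 7))

-- K₄,₄ − 3K₂: sides {a₀..a₃} = 0..3 and {b₀..b₃} = 4..7 (b_t = 4+t);
-- all edges a_s b_t except the three pairwise nonincident edges
-- a₀b₀, a₁b₁, a₂b₂.

K44-3K2 : Graph
K44-3K2 = mkGraph 8 λ x y →
  let i = toℕ x ; j = toℕ y in
  (i <ᵇ 4) ∧ not (j <ᵇ 4) ∧ not ((suc (suc (suc (suc i))) == j) ∧ (i <ᵇ 3))

{-# OPTIONS --safe #-}
module Submission where

open import Defs
open import Data.Product using (_×_; _,_; ∃)
open import Data.Sum using (_⊎_; inj₁; inj₂)
open import Data.Fin using (Fin; _≟_)
open import Data.Fin.Patterns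
open import Data.Fin.Properties using (all?; any?)
open import Data.Maybe using (Maybe; just)
open import Data.Maybe.Properties using (≡-dec)
open import Relation.Nullary using (Dec)
open import Relation.Nullary.Decidable using (True; toWitness; T?; _×-dec_; _⊎-dec_; _→-dec_)
open import Relation.Binary.PropositionalEquality using (_≡_; refl)

-- In each of the three graphs, six vertices span a 6-cycle, and the
-- remaining vertices form a connected set (a triangle or an edge) adjacent
-- to all six; contracting that set gives the hub of W₆.  Every branch set
-- has diameter at most two, so connectivity, like the other conditions on a
-- minor model, becomes a finite check that is decided by evaluation.

module _ (G : Graph) where

  Dist≤2In : (Fin (n G) → Set) → Fin (n G) → Fin (n G) → Set
  Dist≤2In S x y = x ≡ y ⊎ Adj G x y ⊎ ∃ λ z → S z × Adj G x z × Adj G z y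

  walkIn-Dist≤2In : ∀ {S x y} → S x → S y → Dist≤2In S x y → WalkIn G S x y
  walkIn-Dist≤2In Sx Sy (inj₁ refl)                      = here Sx
  walkIn-Dist≤2In Sx Sy (inj₂ (inj₁ xy))                 = step Sx xy (here Sy)
  walkIn-Dist≤2In Sx Sy (inj₂ (inj₂ (z , Sz , xz , zy))) = step Sx xz (step Sz zy (here Sy))

  adj? : ∀ x y → Dec (Adj G x y)
  adj? x y = T? (adj G x y)

  dist≤2In? : ∀ {S} → (∀ z → Dec (S z)) → ∀ x y → Dec (Dist≤2In S x y)
  dist≤2In? S? x y = x ≟ y ⊎-dec adj? x y ⊎-dec any? λ z → S? z ×-dec adj? x z ×-dec adj? z y

module _ {H G : Graph} (φ : Fin (n G) → Maybe (Fin (n H))) where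

  Branch : Fin (n H) → Fin (n G) → Set
  Branch a x = φ x ≡ just a

  IsDiameter≤2Model : Set
  IsDiameter≤2Model =
      (∀ a → ∃ (Branch a))
    × (∀ a x y → Branch a x → Branch a y → Dist≤2In G (Branch a) x y)
    × (∀ a b → Adj H a b → ∃ λ x → ∃ λ y → Branch a x × Branch b y × Adj G x y)

  branch? : ∀ a x → Dec (Branch a x)
  branch? a x = ≡-dec _≟_ (φ x) (just a)

  isDiameter≤2Model? : Dec IsDiameter≤2Model
  isDiameter≤2Model? =
        all? (λ a → any? (branch? a))
    ×-dec all? (λ a → all? λ x → all? λ y →
            branch? a x →-dec branch? a y →-dec dist≤2In? G (branch? a) x y)
    ×-dec all? (λ a → all? λ b → adj? H a b →-dec
            any? λ x → any? λ y → branch? a x ×-dec branch? b y ×-dec adj? G x y)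

  diameter≤2Model⇒≼ : IsDiameter≤2Model → H ≼ G
  diameter≤2Model⇒≼ (nonempty , close , edges) = record
    { φ         = φ
    ; nonempty  = nonempty
    ; connected = λ a x y φx φy → walkIn-Dist≤2In G φx φy (close a x y φx φy)
    ; edges     = edges
    }

  ≼-byDecision : {_ : True isDiameter≤2Model?} → H ≼ G
  ≼-byDecision {model} = diameter≤2Model⇒≼ (toWitness model)

-- Rim (0,0)(0,1)(0,2)(1,2)(1,1)(1,0); the third row, a triangle, is the hub.
LK33-branches : Fin 9 → Maybe (Fin 7)
LK33-branches 0F = just 0F
LK33-branches 1F = just 1F
LK33-branches 2F = just 2F
LK33-branches 3F = just 5F
LK33-branches 4F = just 4F
LK33-branches 5F = just 3F
LK33-branches 6F = just 6F
LK33-branches 7F = just 6F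
LK33-branches 8F = just 6F

-- Rim c₁…c₆; the edge uv is the hub.
AW6+-branches : Fin 8 → Maybe (Fin 7)
AW6+-branches 0F = just 0F
AW6+-branches 1F = just 1F
AW6+-branches 2F = just 2F
AW6+-branches 3F = just 3F
AW6+-branches 4F = just 4F
AW6+-branches 5F = just 5F
AW6+-branches 6F = just 6F
AW6+-branches 7F = just 6F

-- Rim a₀b₂a₁b₀a₂b₁; the edge a₃b₃ is the hub.
K44-3K2-branches : Fin 8 → Maybe (Fin 7)
K44-3K2-branches 0F = just 0F
K44-3K2-branches 1F = just 2F
K44-3K2-branches 2F = just 4F
K44-3K2-branches 3F = just 6F
K44-3K2-branches 4F = just 3F
K44-3K2-branches 5F = just 5F
K44-3K2-branches 6F = just 1F
K44-3K2-branches 7F = just 6F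

lemma4p3 : (W6 ≼ LK33) × (W6 ≼ AW6+) × (W6 ≼ K44-3K2)
lemma4p3 = ≼-byDecision LK33-branches
         , ≼-byDecision AW6+-branches
         , ≼-byDecision K44-3K2-branches
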